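{- Let $G=(S,\mathit{Tr},\mathrm{src},\mathrm{tgt},S_0)$ be a transition system with a function $\mathrm{instr}:\mathit{Tr}\to\mathcal{P}(\mathcal{I})$, $\mathrm{instr}(t)\neq\emptyset$ for all $t$, such that for each $Z\subseteq\mathcal{I}$ and each state $s$ there is at most one transition $t$ with $\mathrm{src}(t)=s$ and $\mathrm{instr}(t)=Z$. Then $\mathrm{WT}\preceq\mathrm{WZ}$: every path of $G$ that is weakly fair w.r.t. the tasks $\{T_Z\mid Z\subseteq\mathcal{I}\}$, $T_Z=\{t\mid\mathrm{instr}(t)=Z\}$, is weakly fair w.r.t. the tasks $\{\{t\}\mid t\in\mathit{Tr}\}$.
   Context: A transition system is $G=(S,\mathit{Tr},\mathrm{src},\mathrm{tgt},S_0)$ with states $S$, transitions $\mathit{Tr}$, $\mathrm{src},\mathrm{tgt}:\mathit{Tr}\to S$, initial states $S_0$. A path is an alternating sequence $s_0t_1s_1t_2\cdots$ of states and transitions, starting with a state, infinite or ending with a state, with $\mathrm{src}(t_i)=s_{i-1}$, $\mathrm{tgt}(t_i)=s_i$. A suffix of $s_0t_1s_1\cdots$ is $s_kt_{k+1}s_{k+1}\cdots$ for some $k$. Given a collection of tasks (subsets of $\mathit{Tr}$), a task $T$ is enabled in $s$ if some $t\in T$ has $\mathrm{src}(t)=s$; perpetually enabled on $\pi$ if enabled in every state of $\pi$; it occurs in $\pi$ if $\pi$ contains a transition of $T$. A path $\pi$ is weakly fair if for every suffix $\pi'$ of $\pi$ each task perpetually enabled on $\pi'$ occurs in $\pi'$.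 WT-fairness is weak fairness w.r.t. singleton tasks $\{t\}$; WZ-fairness is weak fairness w.r.t. the tasks $T_Z$. $H\preceq F$ means every path satisfying $F$ satisfies $H$. -}

module Defs where

open import Level using (Level; _⊔_) renaming (suc to lsuc)
open import Data.Nat using (ℕ; suc; _+_; _<_; _≤_)
open import Data.Maybe using (Maybe; just; nothing)
open import Data.Unit using (⊤)
open import Data.Product using (Σ; ∃; _×_; _,_)
open import Relation.Binary.PropositionalEquality using (_≡_)

record TransitionSystem (a : Level) : Set (lsuc a) where
  field
    State : Set a
    Trans : Set a
    src   : Trans → State
    tgt   : Trans → State
    S₀    : State → Set a

-- Path lengths: finite with n transitions, or infinite.
-- State positions of a path of length ℓ
IsStatePos : Maybe ℕ → ℕ → Set
IsStatePos nothing  i = ⊤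
IsStatePos (just n) i = i ≤ n

IsTransPos : Maybe ℕ → ℕ → Set
IsTransPos nothing  i = ⊤
IsTransPos (just n) i = i < n

module _ {a : Level} (G : TransitionSystem a) where
  open TransitionSystem G

  -- A sequence s₀ t₁ s₁ t₂ ⋯ : len = just n : finite with states s₀…sₙ;
  -- len = nothing : infinite.  st i = sᵢ, tr i = t_{i+1}.
  -- Entries outside the range are irrelevant junk.
  record Seq : Set a where
    constructor mkSeq
    field
      len : Maybe ℕ
      st  : ℕ → State
      tr  : ℕ → Trans

  open Seq public

  IsPath : Seq → Set a
  IsPath π = ∀ i → IsTransPos (len π) i →
               (src (tr π i) ≡ st π i) × (tgt (tr π i) ≡ st π (suc i))

  Task : Set (lsuc a)
  Task = Trans → Set a

  Enabled : Task → State → Set a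
  Enabled T s = Σ Trans λ t → T t × (src t ≡ s)

  -- The suffix s_k t_{k+1} s_{k+1} ⋯ is given by the offset k with
  -- IsStatePos (len π) k.  Perpetually enabled on that suffix:
  PerpEnabledFrom : Seq → ℕ → Task → Set a
  PerpEnabledFrom π k T = ∀ i → IsStatePos (len π) (k + i) → Enabled T (st π (k + i))

  OccursFrom : Seq → ℕ → Task → Set a
  OccursFrom π k T = Σ ℕ λ i → IsTransPos (len π) (k + i) × T (tr π (k + i))

  WeaklyFair : ∀ {j} {J : Set j} → (J → Task) → Seq → Set (a ⊔ j)
  WeaklyFair tasks π = ∀ k → IsStatePos (len π) k → ∀ x →
    PerpEnabledFrom π k (tasks x) → OccursFrom π k (tasks x)

  singletonTask : Trans → Task
  singletonTask t t' = t' ≡ t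

  WT-fair : Seq → Set a
  WT-fair = WeaklyFair singletonTask

-- Subsets of the instruction set 𝓘 as predicates; equality of subsets
-- is extensional (same elements).
module _ {a : Level} where
  _≐_ : {I : Set a} → (I → Set a) → (I → Set a) → Set a
  X ≐ Y = (∀ i → X i → Y i) × (∀ i → Y i → X i)

  T_ : {Tr I : Set a} → (Tr → I → Set a) → (I → Set a) → Tr → Set a
  T_ instr Z t = instr t ≐ Z

  WZ-fair : (G : TransitionSystem a) {I : Set a} →
            (TransitionSystem.Trans G → I → Set a) → Seq G → Set (lsuc a)
  WZ-fair G instr = WeaklyFair G (T_ instr)

{-# OPTIONS --safe #-}
module Submission where

open import Defs
open import Level using (Level)
open import Data.Product using (Σ; _,_; proj₁)
open import Data.Nat using (_+_)
open import Data.Nat.Properties using (<⇒≤)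
open import Data.Maybe using (just; nothing)
open import Data.Unit using (tt)
open import Relation.Binary.PropositionalEquality using (_≡_; refl)

-- A path perpetually enabling {t} also perpetually enables T_{instr t}; the
-- occurrence that WZ-fairness then provides is a transition t′ with the same
-- instruction set as t, leaving the same state (the source of t, since {t} is
-- enabled there), so t′ = t by the uniqueness hypothesis.

≐-refl : ∀ {a} {I : Set a} (X : I → Set a) → X ≐ X
≐-refl X = (λ _ x → x) , (λ _ x → x)

transPos⇒statePos : ∀ l i → IsTransPos l i → IsStatePos l i
transPos⇒statePos nothing  i _   = tt
transPos⇒statePos (just n) i i<n = <⇒≤ i<n

module _ {a : Level} (G : TransitionSystem a) where
  open TransitionSystem G

  src-of-enabled-singleton : ∀ {t s} → Enabled G (singletonTask G t) s → src t ≡ s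
  src-of-enabled-singleton (_ , refl , src≡s) = src≡s

  Enabled-mono : ∀ {A B : Task G} → (∀ t → A t → B t) → ∀ {s} → Enabled G A s → Enabled G B s
  Enabled-mono A⊆B (t , At , src≡s) = t , A⊆B t At , src≡s

  PerpEnabledFrom-mono : ∀ {A B : Task G} → (∀ t → A t → B t) →
    ∀ π k → PerpEnabledFrom G π k A → PerpEnabledFrom G π k B
  PerpEnabledFrom-mono A⊆B π k enabled i i∈π = Enabled-mono A⊆B (enabled i i∈π)

  singleton⊆T-instr : ∀ {I : Set a} (instr : Trans → I → Set a) t t′ →
    singletonTask G t t′ → T_ instr (instr t) t′
  singleton⊆T-instr instr t .t refl = ≐-refl (instr t)

  module _ {I : Set a} (instr : Trans → I → Set a)
    (instr-unique : ∀ (Z : I → Set a) (s : State) (t t′ : Trans) →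
      src t ≡ s → instr t ≐ Z → src t′ ≡ s → instr t′ ≐ Z → t ≡ t′) where

    occurs-singleton : ∀ π → IsPath G π → ∀ k t →
      PerpEnabledFrom G π k (singletonTask G t) →
      OccursFrom G π k (T_ instr (instr t)) → OccursFrom G π k (singletonTask G t)
    occurs-singleton π path k t enabled (i , i∈π , same-instr) =
      i , i∈π , instr-unique (instr t) (st π (k + i)) _ t
        (proj₁ (path (k + i) i∈π)) same-instr
        (src-of-enabled-singleton (enabled i (transPos⇒statePos (len π) (k + i) i∈π)))
        (≐-refl (instr t))

proposition5p12 : ∀ {a : Level} (G : TransitionSystem a) (I : Set a)
    (instr : TransitionSystem.Trans G → I → Set a) →
    (∀ t → Σ I λ i → instr t i) →
    (∀ (Z : I → Set a) (s : TransitionSystem.State G) (t t′ : TransitionSystem.Trans G) →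
      TransitionSystem.src G t ≡ s → instr t ≐ Z →
      TransitionSystem.src G t′ ≡ s → instr t′ ≐ Z → t ≡ t′) →
    ∀ (π : Seq G) → IsPath G π → WZ-fair G instr π → WT-fair G π
proposition5p12 G I instr _ instr-unique π path wz-fair k k∈π t enabled =
  occurs-singleton G instr instr-unique π path k t enabled
    (wz-fair k k∈π (instr t)
      (PerpEnabledFrom-mono G (singleton⊆T-instr G instr t) π k enabled))
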